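{- Let $G$ be a finite simple connected graph of order $n$ and let $k\ge 0$ be an integer. Then $$\left\lceil \frac{n}{\mu_k(G)}\right\rceil \le \tau_k(G)\le 1+\left\lceil \frac{n-\mu_k(G)}{k+2}\right\rceil .$$
   Context: For $X\subseteq V(G)$, vertices $u,v$ are $(X,k)$-visible if some shortest $(u,v)$-path in $G$ has at most $k$ internal vertices in $X$; $X$ is a mutual $k$-visible set if every pair of distinct vertices of $X$ is $(X,k)$-visible; $\mu_k(G)$ is the maximum cardinality of a mutual $k$-visible set. A mutual $k$-visibility cover of $G$ is a partition of $V(G)$ in which every part is a mutual $k$-visible set in $G$; $\tau_k(G)$ is the minimum number of parts of a mutual $k$-visibility cover of $G$. -}

module Defs where

open import Data.Nat using (ℕ; zero; suc; _+_; _≤_; _/_; NonZero)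
open import Data.Fin using (Fin)
open import Data.Fin.Subset using (Subset; _∈_; ∣_∣)
open import Data.Fin.Subset.Properties using (_∈?_)
open import Data.Bool using (Bool; true; false)
open import Data.List using (List; []; _∷_; _++_; length; filter)
open import Data.List.Relation.Unary.Linked using (Linked)
open import Data.Product using (Σ; _×_; ∃; ∃-syntax)
open import Relation.Binary.PropositionalEquality using (_≡_; _≢_)

record Graph (n : ℕ) : Set where
  field
    adj     : Fin n → Fin n → Bool
    sym     : ∀ u v → adj u v ≡ adj v u
    irrefl  : ∀ u → adj u u ≡ false

module _ {n : ℕ} (G : Graph n) where
  open Graph G

  Adj : Fin n → Fin n → Set
  Adj u v = adj u v ≡ true

  -- ws is the list of internal vertices of a (u,v)-walk u, w1, ..., wr, v
  -- (its length as a walk is  length ws + 1).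
  IsWalk : Fin n → Fin n → List (Fin n) → Set
  IsWalk u v ws = Linked Adj (u ∷ ws ++ v ∷ [])

  IsShortest : Fin n → Fin n → List (Fin n) → Set
  IsShortest u v ws = IsWalk u v ws × (∀ ws′ → IsWalk u v ws′ → length ws ≤ length ws′)

  Connected : Set
  Connected = NonZero n × (∀ u v → u ≢ v → ∃[ ws ] IsWalk u v ws)

  countIn : Subset n → List (Fin n) → ℕ
  countIn X ws = length (filter (_∈? X) ws)

  Visible : Subset n → ℕ → Fin n → Fin n → Set
  Visible X k u v = ∃[ ws ] (IsShortest u v ws × countIn X ws ≤ k)

  MutualVisible : ℕ → Subset n → Set
  MutualVisible k X = ∀ u v → u ∈ X → v ∈ X → u ≢ v → Visible X k u v

  IsMu : ℕ → ℕ → Set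
  IsMu k m = (∃[ X ] (MutualVisible k X × ∣ X ∣ ≡ m))
           × (∀ X → MutualVisible k X → ∣ X ∣ ≤ m)

  part : {t : ℕ} → (Fin n → Fin t) → Fin t → Subset n
  part c i = Data.Vec.tabulate (λ v → isYes (c v Data.Fin.≟ i))
    where
      open import Relation.Nullary.Decidable using (isYes)
      import Data.Vec
      import Data.Fin

  -- a mutual k-visibility cover with exactly t (non-empty) parts:
  -- a surjective labelling of the vertices by Fin t whose classes are mutual k-visible
  IsCover : ℕ → (t : ℕ) → (Fin n → Fin t) → Set
  IsCover k t c = (∀ i → ∃[ v ] c v ≡ i) × (∀ i → MutualVisible k (part c i))

  IsTau : ℕ → ℕ → Set
  IsTau k t = (∃[ c ] IsCover k t c)
            × (∀ t′ (c : Fin n → Fin t′) → IsCover k t′ c → t ≤ t′)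

-- ceiling division ⌈ a / b ⌉ (the value at b = 0 is an unused junk value 0)
ceilDiv : ℕ → ℕ → ℕ
ceilDiv a zero    = 0
ceilDiv a (suc b) = (a + b) / suc b

module Submission where

-- Lower bound: the τ parts of a cover partition the n vertices and each has at most
-- μ elements, so n ≤ τ μ.
-- Upper bound: a shortest path visits no vertex twice, so at most ∣P∣ - 2 internal
-- vertices of a shortest path between two vertices of P lie in P; hence every set of
-- at most k + 2 vertices is mutual k-visible. A maximum mutual k-visible set X, together
-- with the n - μ remaining vertices cut (in increasing order) into blocks of k + 2, is
-- then a cover with 1 + ⌈(n - μ)/(k + 2)⌉ parts.

open import Defs
open import Data.Bool using (true)
import Data.Bool.Properties as Bool
open import Data.Fin using (Fin; zero; suc; toℕ; fromℕ<; _≟_)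
import Data.Fin.Properties as Fin
open import Data.Fin.Properties using (any?; toℕ-fromℕ<; toℕ-injective; toℕ<n)
open import Data.Fin.Subset using (Subset; inside; outside; _∈_; ∣_∣; ∁; _-_; Nonempty; ⁅_⁆)
open import Data.Fin.Subset.Properties
  using (_∈?_; x∈p∧x≢y⇒x∈p-y; x∈p⇒∣p-x∣<∣p∣; x∉p⇒x∈∁p; x∈∁p⇒x∉p; ∣∁p∣≡n∸∣p∣; ⊆-antisym;
         ∈⊤; ∣⊤∣≡n; ∣⁅x⁆∣≡1; x∈⁅y⁆⇒x≡y)
open import Data.List using ([]; _∷_; _++_; length; filter)
open import Data.List.Properties using (length-++)
import Data.List.Membership.Propositional as List
open import Data.List.Membership.Propositional.Properties using (∈-∃++)
import Data.List.Relation.Unary.All as All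
open import Data.List.Relation.Unary.All using (All; []; _∷_)
import Data.List.Relation.Unary.All.Properties as All
open import Data.List.Relation.Unary.All.Properties using (¬Any⇒All¬; all-filter)
open import Data.List.Relation.Unary.AllPairs using ([]; _∷_)
open import Data.List.Relation.Unary.Any using (here; there)
import Data.List.Relation.Unary.Linked as Linked
open import Data.List.Relation.Unary.Linked using ([-]; _∷_)
open import Data.List.Relation.Unary.Unique.Propositional using (Unique)
import Data.List.Relation.Unary.Unique.Propositional.Properties as Unique
open import Data.Nat
  using (ℕ; zero; suc; _+_; _*_; _∸_; _/_; _%_; _≤_; _<_; z≤n; s≤s; s≤s⁻¹; >-nonZero⁻¹)
open import Data.Nat.DivMod using (m<n*o⇒m/o<n; m≡m%n+[m/n]*n; m%n<n; m*n/n≡m; _mod_)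
open import Data.Nat.Induction using (<-wellFounded)
open import Data.Nat.Properties
  using (+-0-commutativeMonoid; +-comm; +-cancelʳ-≤; +-mono-≤; +-monoˡ-≤; +-mono-≤-<; n<1+n; m≤n+m;
         ≤-trans; ≤-reflexive; <⇒≱; ≰⇒>; ≮⇒≥; suc-injective; anyUpTo?; module ≤-Reasoning)
import Data.Product as Product
open import Data.Product using (_×_; _,_; proj₂; ∃-syntax)
open import Data.Vec using ([]; _∷_; here; there; tabulate)
open import Data.Vec.Properties using (lookup⇒[]=; []=⇒lookup; lookup∘tabulate)
open import Function using (_∘_)
open import Induction.WellFounded using (Acc; acc)
open import Relation.Binary.PropositionalEquality
  using (_≡_; refl; sym; trans; cong; cong₂; subst; module ≡-Reasoning)
open import Relation.Nullary using (¬_; Dec; yes; no; contradiction)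
open import Relation.Nullary.Decidable using (isYes; map′; _×-dec_; isYes≗does; dec-true; ⌊⌋-map′)
open import Relation.Unary using (Decidable)
open import Algebra.Properties.CommutativeMonoid.Sum +-0-commutativeMonoid
  using (sum-syntax; sum-cong-≗; ∑-distrib-+; sum-replicate-zero)

ceilDiv-least : ∀ m t d → m ≤ t * d → ceilDiv m d ≤ t
ceilDiv-least m t zero    _    = z≤n
ceilDiv-least m t (suc e) m≤td = s≤s⁻¹ (m<n*o⇒m/o<n (begin-strict
  m + e             <⟨ +-mono-≤-< m≤td (n<1+n e) ⟩
  t * suc e + suc e ≡⟨ +-comm (t * suc e) (suc e) ⟩
  suc t * suc e     ∎))
  where open ≤-Reasoning

m≤ceilDiv*d : ∀ m e → m ≤ ceilDiv m (suc e) * suc e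
m≤ceilDiv*d m e = +-cancelʳ-≤ e m _ (begin
  m + e                       ≡⟨ m≡m%n+[m/n]*n (m + e) (suc e) ⟩
  (m + e) % suc e + q * suc e ≤⟨ +-monoˡ-≤ (q * suc e) (s≤s⁻¹ (m%n<n (m + e) (suc e))) ⟩
  e + q * suc e               ≡⟨ +-comm e (q * suc e) ⟩
  q * suc e + e               ∎)
  where
  open ≤-Reasoning
  q = ceilDiv m (suc e)

/<ceilDiv : ∀ {r m} e → r < m → r / suc e < ceilDiv m (suc e)
/<ceilDiv {m = m} e r<m = m<n*o⇒m/o<n (≤-trans r<m (m≤ceilDiv*d m e))

<ceilDiv⇒*< : ∀ {j m} e → j < ceilDiv m (suc e) → j * suc e < m
<ceilDiv⇒*< {j} {m} e j<q = ≰⇒> λ m≤jd → <⇒≱ j<q (ceilDiv-least m j (suc e) m≤jd)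

%-/-injective : ∀ {m n} e → m % suc e ≡ n % suc e → m / suc e ≡ n / suc e → m ≡ n
%-/-injective {m} {n} e %≡ /≡ = begin
  m                             ≡⟨ m≡m%n+[m/n]*n m (suc e) ⟩
  m % suc e + m / suc e * suc e ≡⟨ cong₂ (λ r q → r + q * suc e) %≡ /≡ ⟩
  n % suc e + n / suc e * suc e ≡⟨ m≡m%n+[m/n]*n n (suc e) ⟨
  n                             ∎
  where open ≡-Reasoning

∣x∷p∣≡∣x∷[]∣+∣p∣ : ∀ {n} x (p : Subset n) → ∣ x ∷ p ∣ ≡ ∣ x ∷ [] ∣ + ∣ p ∣
∣x∷p∣≡∣x∷[]∣+∣p∣ inside  p = refl
∣x∷p∣≡∣x∷[]∣+∣p∣ outside p = refl

∣p∣>0⇒Nonempty : ∀ {n} {p : Subset n} → 0 < ∣ p ∣ → Nonempty p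
∣p∣>0⇒Nonempty {p = inside  ∷ p} _ = zero , here
∣p∣>0⇒Nonempty {p = outside ∷ p} h = Product.map suc there (∣p∣>0⇒Nonempty h)

Unique⇒length≤∣p∣ : ∀ {n} {p : Subset n} {xs} → Unique xs → All (_∈ p) xs → length xs ≤ ∣ p ∣
Unique⇒length≤∣p∣ []                 []           = z≤n
Unique⇒length≤∣p∣ (x≢xs ∷ xs-unique) (x∈p ∷ xs⊆p) =
  ≤-trans (s≤s (Unique⇒length≤∣p∣ xs-unique xs⊆p-x)) (x∈p⇒∣p-x∣<∣p∣ x∈p)
  where
  xs⊆p-x = All.zipWith (λ (x≢y , y∈p) → x∈p∧x≢y⇒x∈p-y y∈p (x≢y ∘ sym)) (x≢xs , xs⊆p)

injectiveOn⇒∣p∣≤∣q∣ : ∀ {m n} {p : Subset n} {q : Subset m} (f : Fin n → Fin m) →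
  (∀ {x} → x ∈ p → f x ∈ q) → (∀ {x y} → x ∈ p → y ∈ p → f x ≡ f y → x ≡ y) → ∣ p ∣ ≤ ∣ q ∣
injectiveOn⇒∣p∣≤∣q∣ {p = []}          f into inj = z≤n
injectiveOn⇒∣p∣≤∣q∣ {p = outside ∷ p} f into inj =
  injectiveOn⇒∣p∣≤∣q∣ (f ∘ suc) (into ∘ there)
    (λ x∈p y∈p → Fin.suc-injective ∘ inj (there x∈p) (there y∈p))
injectiveOn⇒∣p∣≤∣q∣ {p = inside ∷ p} {q} f into inj =
  ≤-trans (s≤s (injectiveOn⇒∣p∣≤∣q∣ (f ∘ suc) into-q-fzero inj-suc)) (x∈p⇒∣p-x∣<∣p∣ (into here))
  where
  into-q-fzero : ∀ {x} → x ∈ p → f (suc x) ∈ q - f zero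
  into-q-fzero x∈p = x∈p∧x≢y⇒x∈p-y (into (there x∈p)) (Fin.0≢1+n ∘ inj here (there x∈p) ∘ sym)

  inj-suc : ∀ {x y} → x ∈ p → y ∈ p → f (suc x) ≡ f (suc y) → x ≡ y
  inj-suc x∈p y∈p = Fin.suc-injective ∘ inj (there x∈p) (there y∈p)

rank : ∀ {n} → Subset n → Fin n → ℕ
rank (_       ∷ p) zero    = 0
rank (inside  ∷ p) (suc x) = suc (rank p x)
rank (outside ∷ p) (suc x) = rank p x

rank-< : ∀ {n} {p : Subset n} {x} → x ∈ p → rank p x < ∣ p ∣
rank-< here                          = s≤s z≤n
rank-< {p = inside  ∷ p} (there x∈p) = s≤s (rank-< x∈p)
rank-< {p = outside ∷ p} (there x∈p) = rank-< x∈p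

rank-injective : ∀ {n} {p : Subset n} {x y} → x ∈ p → y ∈ p → rank p x ≡ rank p y → x ≡ y
rank-injective here here _ = refl
rank-injective {p = inside ∷ p} (there x∈p) (there y∈p) eq =
  cong suc (rank-injective x∈p y∈p (suc-injective eq))
rank-injective {p = outside ∷ p} (there x∈p) (there y∈p) eq =
  cong suc (rank-injective x∈p y∈p eq)

rank-surjective : ∀ {n} (p : Subset n) {r} → r < ∣ p ∣ → ∃[ x ] x ∈ p × rank p x ≡ r
rank-surjective (inside  ∷ p) {zero}  _     = zero , here , refl
rank-surjective (inside  ∷ p) {suc r} r<∣p∣ =
  Product.map suc (Product.map there (cong suc)) (rank-surjective p (s≤s⁻¹ r<∣p∣))
rank-surjective (outside ∷ p) r<∣p∣ =
  Product.map suc (Product.map₁ there) (rank-surjective p r<∣p∣)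

-- `part G c i` unfolds to `fibre c i`.
fibre : ∀ {n t} → (Fin n → Fin t) → Fin t → Subset n
fibre c i = tabulate (λ x → isYes (c x ≟ i))

∈-fibre⁺ : ∀ {n t} {c : Fin n → Fin t} {x i} → c x ≡ i → x ∈ fibre c i
∈-fibre⁺ {c = c} {x} refl = lookup⇒[]= x (fibre c (c x))
  (trans (lookup∘tabulate _ x) (trans (isYes≗does (c x ≟ c x)) (dec-true (c x ≟ c x) refl)))

∈-fibre⁻ : ∀ {n t} {c : Fin n → Fin t} {x i} → x ∈ fibre c i → c x ≡ i
∈-fibre⁻ {c = c} {x} {i} x∈ with c x ≟ i | trans (sym (lookup∘tabulate _ x)) ([]=⇒lookup x∈)
... | yes cx≡i | _ = cx≡i
... | no  _    | ()

∑-∣a≟i∣≡1 : ∀ {t} (a : Fin t) → ∑[ i < t ] ∣ isYes (a ≟ i) ∷ [] ∣ ≡ 1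
∑-∣a≟i∣≡1 {suc t} zero    = cong suc (sum-replicate-zero t)
∑-∣a≟i∣≡1 {suc t} (suc a) =
  trans (sum-cong-≗ (λ i → cong (λ b → ∣ b ∷ [] ∣) (⌊⌋-map′ _ _ (a ≟ i)))) (∑-∣a≟i∣≡1 a)

∑∣fibre∣≡n : ∀ {n t} (c : Fin n → Fin t) → ∑[ i < t ] ∣ fibre c i ∣ ≡ n
∑∣fibre∣≡n {zero}  {t} c = sum-replicate-zero t
∑∣fibre∣≡n {suc n} {t} c = begin
  ∑[ i < t ] ∣ fibre c i ∣
    ≡⟨ sum-cong-≗ (λ i → ∣x∷p∣≡∣x∷[]∣+∣p∣ (isYes (c zero ≟ i)) (fibre (c ∘ suc) i)) ⟩
  ∑[ i < t ] (∣ isYes (c zero ≟ i) ∷ [] ∣ + ∣ fibre (c ∘ suc) i ∣)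
    ≡⟨ ∑-distrib-+ (λ i → ∣ isYes (c zero ≟ i) ∷ [] ∣) (λ i → ∣ fibre (c ∘ suc) i ∣) ⟩
  ∑[ i < t ] ∣ isYes (c zero ≟ i) ∷ [] ∣ + ∑[ i < t ] ∣ fibre (c ∘ suc) i ∣
    ≡⟨ cong₂ _+_ (∑-∣a≟i∣≡1 (c zero)) (∑∣fibre∣≡n (c ∘ suc)) ⟩
  suc n
    ∎
  where open ≡-Reasoning

∑≤t*b : ∀ {t b} (f : Fin t → ℕ) → (∀ i → f i ≤ b) → ∑[ i < t ] f i ≤ t * b
∑≤t*b {zero}  f _   = z≤n
∑≤t*b {suc t} f f≤b = +-mono-≤ (f≤b zero) (∑≤t*b (f ∘ suc) (f≤b ∘ suc))

∣fibre∣≤b⇒n≤t*b : ∀ {n t b} (c : Fin n → Fin t) → (∀ i → ∣ fibre c i ∣ ≤ b) → n ≤ t * b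
∣fibre∣≤b⇒n≤t*b c ∣fibre∣≤b = subst (_≤ _) (∑∣fibre∣≡n c) (∑≤t*b _ ∣fibre∣≤b)

module _ {P : ℕ → Set} (P? : Decidable P) where

  least : ∀ {n} → Acc _<_ n → P n → ∃[ m ] P m × (∀ {j} → j < m → ¬ P j)
  least {n} (acc smaller) Pn with anyUpTo? P? n
  ... | yes (m , m<n , Pm) = least (smaller m<n) Pm
  ... | no  none           = n , Pn , λ j<n Pj → none (_ , j<n , Pj)

module _ {n : ℕ} (G : Graph n) where
  open Graph G using (adj)

  WalkOfLength : ℕ → Fin n → Fin n → Set
  WalkOfLength j u v = ∃[ ws ] length ws ≡ j × IsWalk G u v ws

  walkOfLength? : ∀ j u v → Dec (WalkOfLength j u v)
  walkOfLength? zero u v = map′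
    (λ uv → [] , refl , uv ∷ [-])
    (λ { ([] , _ , uv ∷ [-]) → uv })
    (adj u v Bool.≟ true)
  walkOfLength? (suc j) u v = map′
    (λ (w , uw , ws , len , walk) → w ∷ ws , cong suc len , uw ∷ walk)
    (λ { (w ∷ ws , len , uw ∷ walk) → w , uw , ws , suc-injective len , walk })
    (any? λ w → (adj u w Bool.≟ true) ×-dec walkOfLength? j w v)

  shortestPath : ∀ {u v ws} → IsWalk G u v ws → ∃[ ws′ ] IsShortest G u v ws′
  shortestPath {u} {v} {ws} walk
    with least (λ j → walkOfLength? j u v) (<-wellFounded (length ws)) (ws , refl , walk)
  ... | _ , (ws′ , refl , walk′) , none =
    ws′ , walk′ , λ ws″ walk″ → ≮⇒≥ λ shorter → none shorter (ws″ , refl , walk″)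

  walk-suffix : ∀ {u v x} as bs → IsWalk G u v (as ++ x ∷ bs) → IsWalk G x v bs
  walk-suffix []       bs walk = Linked.tail walk
  walk-suffix (_ ∷ as) bs walk = walk-suffix as bs (Linked.tail walk)

  shortest-tail : ∀ {u v w ws} → IsShortest G u v (w ∷ ws) → IsShortest G w v ws
  shortest-tail {w = w} (walk , minimal) =
    Linked.tail walk , λ ws′ walk′ → s≤s⁻¹ (minimal (w ∷ ws′) (Linked.head walk ∷ walk′))

  source∉shortest : ∀ {u v ws} → IsShortest G u v ws → u List.∉ ws
  source∉shortest (walk , minimal) u∈ws with ∈-∃++ u∈ws
  ... | as , bs , refl = <⇒≱ (≤-trans (m≤n+m _ (length as)) (≤-reflexive (sym (length-++ as))))
                             (minimal bs (walk-suffix as bs walk))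

  target∉shortest : ∀ {u v ws} → IsShortest G u v ws → v List.∉ ws
  target∉shortest (walk , minimal) (here refl) with () ← minimal [] (Linked.head walk ∷ [-])
  target∉shortest shortest (there v∈ws) = target∉shortest (shortest-tail shortest) v∈ws

  shortest-Unique : ∀ {u v ws} → IsShortest G u v ws → Unique ws
  shortest-Unique {ws = []}     _        = []
  shortest-Unique {ws = w ∷ ws} shortest = ¬Any⇒All¬ ws (source∉shortest tail) ∷ shortest-Unique tail
    where tail = shortest-tail shortest

  singleton-mutualVisible : ∀ k x → MutualVisible G k ⁅ x ⁆
  singleton-mutualVisible k x u v u∈ v∈ u≢v =
    contradiction (trans (x∈⁅y⁆⇒x≡y x u∈) (sym (x∈⁅y⁆⇒x≡y x v∈))) u≢v

  μ-positive : Connected G → ∀ {k μ} → IsMu G k μ → 0 < μ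
  μ-positive (nonZero , _) (_ , maximum) =
    subst (_≤ _) (∣⁅x⁆∣≡1 x) (maximum ⁅ x ⁆ (singleton-mutualVisible _ x))
    where
    x : Fin n
    x = fromℕ< (>-nonZero⁻¹ n {{nonZero}})

  ∣P∣≤2+k⇒mutualVisible : Connected G → ∀ k {P} → ∣ P ∣ ≤ 2 + k → MutualVisible G k P
  ∣P∣≤2+k⇒mutualVisible (_ , connected) k {P} ∣P∣≤2+k u v u∈P v∈P u≢v
    with ws , shortest ← shortestPath (proj₂ (connected u v u≢v)) =
    ws , shortest , s≤s⁻¹ (s≤s⁻¹ (≤-trans (Unique⇒length≤∣p∣ u∷v∷ws∩P-unique u∷v∷ws∩P⊆P) ∣P∣≤2+k))
    where
    u∷v∷ws∩P-unique : Unique (u ∷ v ∷ filter (_∈? P) ws)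
    u∷v∷ws∩P-unique =
        (u≢v ∷ All.filter⁺ (_∈? P) (¬Any⇒All¬ ws (source∉shortest shortest)))
      ∷ All.filter⁺ (_∈? P) (¬Any⇒All¬ ws (target∉shortest shortest))
      ∷ Unique.filter⁺ (_∈? P) (shortest-Unique shortest)

    u∷v∷ws∩P⊆P : All (_∈ P) (u ∷ v ∷ filter (_∈? P) ws)
    u∷v∷ws∩P⊆P = u∈P ∷ v∈P ∷ all-filter (_∈? P) ws

module Blocks {n : ℕ} (X : Subset n) (e : ℕ) where

  blocks : ℕ
  blocks = ceilDiv ∣ ∁ X ∣ (suc e)

  label : Fin n → Fin (suc blocks)
  label x with x ∈? X
  ... | yes _   = zero
  ... | no  x∉X = suc (fromℕ< (/<ceilDiv e (rank-< (x∉p⇒x∈∁p x∉X))))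

  label-zero⁺ : ∀ {x} → x ∈ X → label x ≡ zero
  label-zero⁺ {x} x∈X with x ∈? X
  ... | yes _   = refl
  ... | no  x∉X = contradiction x∈X x∉X

  label-zero⁻ : ∀ {x} → label x ≡ zero → x ∈ X
  label-zero⁻ {x} _ with x ∈? X
  ... | yes x∈X = x∈X

  label-suc⁻ : ∀ {x j} → label x ≡ suc j → x ∈ ∁ X × rank (∁ X) x / suc e ≡ toℕ j
  label-suc⁻ {x} eq with x ∈? X
  ... | no  x∉X = x∉p⇒x∈∁p x∉X , trans (sym (toℕ-fromℕ< _)) (cong toℕ (Fin.suc-injective eq))

  toℕ-label-∈∁ : ∀ {x} → x ∈ ∁ X → toℕ (label x) ≡ suc (rank (∁ X) x / suc e)
  toℕ-label-∈∁ {x} x∈∁X with x ∈? X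
  ... | yes x∈X = contradiction x∈X (x∈∁p⇒x∉p x∈∁X)
  ... | no  _   = cong suc (toℕ-fromℕ< _)

  label-surjective : ∀ j → ∃[ x ] label x ≡ suc j
  label-surjective j with x , x∈∁X , rank≡ ← rank-surjective (∁ X) (<ceilDiv⇒*< e (toℕ<n j)) =
    x , toℕ-injective (begin
      toℕ (label x)               ≡⟨ toℕ-label-∈∁ x∈∁X ⟩
      suc (rank (∁ X) x / suc e)  ≡⟨ cong (λ r → suc (r / suc e)) rank≡ ⟩
      suc (toℕ j * suc e / suc e) ≡⟨ cong suc (m*n/n≡m (toℕ j) (suc e)) ⟩
      suc (toℕ j)                 ∎)
    where open ≡-Reasoning

  -- Within one block, a rank is determined by its residue modulo the block size.
  ∣fibre-suc∣≤ : ∀ j → ∣ fibre label (suc j) ∣ ≤ suc e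
  ∣fibre-suc∣≤ j = subst (∣ fibre label (suc j) ∣ ≤_) (∣⊤∣≡n (suc e))
    (injectiveOn⇒∣p∣≤∣q∣ (λ x → rank (∁ X) x mod suc e) (λ _ → ∈⊤) injective)
    where
    injective : ∀ {x y} → x ∈ fibre label (suc j) → y ∈ fibre label (suc j) →
                rank (∁ X) x mod suc e ≡ rank (∁ X) y mod suc e → x ≡ y
    injective x∈ y∈ mod≡
      with x∈∁X , x/d≡j ← label-suc⁻ (∈-fibre⁻ x∈) | y∈∁X , y/d≡j ← label-suc⁻ (∈-fibre⁻ y∈) =
      rank-injective x∈∁X y∈∁X (%-/-injective e
        (trans (sym (toℕ-fromℕ< _)) (trans (cong toℕ mod≡) (toℕ-fromℕ< _)))
        (trans x/d≡j (sym y/d≡j)))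

module _ {n : ℕ} (G : Graph n) (connected : Connected G) (k : ℕ) {X : Subset n} where
  open Blocks X (suc k)

  label-isCover : MutualVisible G k X → Nonempty X → IsCover G k (suc blocks) label
  label-isCover X-visible (x , x∈X) = surjective , visible
    where
    surjective : ∀ i → ∃[ v ] label v ≡ i
    surjective zero    = x , label-zero⁺ x∈X
    surjective (suc j) = label-surjective j

    fibre-zero : fibre label zero ≡ X
    fibre-zero = ⊆-antisym (label-zero⁻ ∘ ∈-fibre⁻) (∈-fibre⁺ ∘ label-zero⁺)

    visible : ∀ i → MutualVisible G k (part G label i)
    visible zero    = subst (MutualVisible G k) (sym fibre-zero) X-visible
    visible (suc j) = ∣P∣≤2+k⇒mutualVisible G connected k (∣fibre-suc∣≤ j)

lemma8p5 : ∀ {n : ℕ} (G : Graph n) → Connected G → (k μ τ : ℕ) →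
    IsMu G k μ → IsTau G k τ →
    ceilDiv n μ ≤ τ × τ ≤ 1 + ceilDiv (n ∸ μ) (suc (suc k))
lemma8p5 {n} G connected k μ τ
  isMu@((X , X-visible , ∣X∣≡μ) , μ-maximum) ((c , c-cover) , τ-minimum) = lower , upper
  where
  lower : ceilDiv n μ ≤ τ
  lower = ceilDiv-least n τ μ (∣fibre∣≤b⇒n≤t*b c λ i → μ-maximum (part G c i) (proj₂ c-cover i))

  X-nonempty : Nonempty X
  X-nonempty = ∣p∣>0⇒Nonempty (subst (0 <_) (sym ∣X∣≡μ) (μ-positive G connected isMu))

  open Blocks X (suc k) using (blocks; label)

  ∣∁X∣≡n∸μ : ∣ ∁ X ∣ ≡ n ∸ μ
  ∣∁X∣≡n∸μ = trans (∣∁p∣≡n∸∣p∣ X) (cong (n ∸_) ∣X∣≡μ)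

  upper : τ ≤ 1 + ceilDiv (n ∸ μ) (suc (suc k))
  upper = subst (λ m → τ ≤ suc (ceilDiv m (suc (suc k)))) ∣∁X∣≡n∸μ
    (τ-minimum (suc blocks) label (label-isCover G connected k X-visible X-nonempty))
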